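{- Let $q$ be a power of a prime $p\ge5$, and consider $\lambda\in\mathbb{F}_q\setminus\{0,1\}$ with $j(E^{\mathrm{Leg}}_\lambda)=0$. (1) If $q\equiv2\pmod3$, there is no such $\lambda$. (2) If $q\equiv1\pmod{12}$, then $\left|L\!\left(\frac{1\pm\sqrt{ -3}}{2}\right)\right|=2$, and $\frac{1\pm\sqrt{ -3}}{2}$ are squares in $\mathbb{F}_q$. (3) If $q\equiv7\pmod{12}$, then $\left|L\!\left(\frac{1\pm\sqrt{ -3}}{2}\right)\right|=1$, and $\frac{1\pm\sqrt{ -3}}{2}$ are both non-squares in $\mathbb{F}_q$.
   Context: For $\lambda\in\mathbb{F}_q\setminus\{0,1\}$, $E^{\mathrm{Leg}}_\lambda: y^2=x(x-1)(x-\lambda)$, with $j(E^{\mathrm{Leg}}_\lambda)=2^8(\lambda^2-\lambda+1)^3/(\lambda^2(\lambda-1)^2)$; the $\lambda$ with $j=0$ are $\frac{1\pm\sqrt{ -3}}{2}$. Define $L(\lambda):=\{\beta\in\mathbb{F}_q\setminus\{0,1\}:\ E^{\mathrm{Leg}}_\beta\cong E^{\mathrm{Leg}}_\lambda \text{ over } \mathbb{F}_q\}$. -}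

module Defs where

open import Data.Nat as ℕ using (ℕ; zero; suc)
open import Data.Fin using (Fin)
open import Data.List using (List; length)
open import Data.List.Relation.Unary.Unique.Propositional using (Unique)
open import Data.List.Membership.Propositional using (_∈_)
open import Data.Product using (Σ; ∃; ∃-syntax; _×_; _,_)
open import Relation.Binary.PropositionalEquality using (_≡_; _≢_)
open import Algebra.Structures using (IsCommutativeRing)
open import Function.Bundles using (_↔_)

record FiniteField : Set₁ where
  infixl 6 _+_ _-_
  infixl 7 _*_
  field
    Carrier : Set
    _+_ _*_ : Carrier → Carrier → Carrier
    -_      : Carrier → Carrier
    0# 1#   : Carrier
    _⁻¹     : Carrier → Carrier
    isCommutativeRing : IsCommutativeRing _≡_ _+_ _*_ -_ 0# 1#
    0≢1     : 0# ≢ 1#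
    ⁻¹-inverse : ∀ x → x ≢ 0# → x * (x ⁻¹) ≡ 1#
    card    : ℕ
    enum    : Carrier ↔ Fin card

  _-_ : Carrier → Carrier → Carrier
  x - y = x + (- y)

module FF (F : FiniteField) where
  open FiniteField F public

  fromℕ : ℕ → Carrier
  fromℕ zero = 0#
  fromℕ (suc n) = 1# + fromℕ n

  jLeg : Carrier → Carrier
  jLeg l = fromℕ 256 * ((l * l - l + 1#) * (l * l - l + 1#) * (l * l - l + 1#))
                     * ((l * l * ((l - 1#) * (l - 1#))) ⁻¹)

  record Weierstrass : Set where
    constructor mkW
    field a1 a2 a3 a4 a6 : Carrier

  -- Legendre curve y² = x(x-1)(x-l) = x³ - (1+l)x² + l x
  Leg : Carrier → Weierstrass
  Leg l = mkW 0# (- (1# + l)) 0# l 0#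

  -- Isomorphism over F_q (Silverman, III.1 / Table 3.1): E' is obtained from E by
  -- x = u²x' + r, y = u³y' + u²s x' + t with u ≠ 0.
  _≅_ : Weierstrass → Weierstrass → Set
  mkW a1 a2 a3 a4 a6 ≅ mkW b1 b2 b3 b4 b6 =
    Σ Carrier λ u → Σ Carrier λ r → Σ Carrier λ s → Σ Carrier λ t →
      (u ≢ 0#)
    × (u * b1 ≡ a1 + fromℕ 2 * s)
    × (u * u * b2 ≡ a2 - s * a1 + fromℕ 3 * r - s * s)
    × (u * u * u * b3 ≡ a3 + r * a1 + fromℕ 2 * t)
    × (u * u * u * u * b4 ≡ a4 - s * a3 + fromℕ 2 * r * a2 - (t + r * s) * a1
                            + fromℕ 3 * r * r - fromℕ 2 * s * t)
    × (u * u * u * u * u * u * b6 ≡ a6 + r * a4 + r * r * a2 + r * r * r - t * a3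
                                    - t * t - r * t * a1)

  L : Carrier → Carrier → Set
  L l β = (β ≢ 0#) × (β ≢ 1#) × (Leg β ≅ Leg l)

  HasSize : (Carrier → Set) → ℕ → Set
  HasSize P n = Σ (List Carrier) λ xs →
    Unique xs × (length xs ≡ n) × (∀ β → (P β → β ∈ xs) × (β ∈ xs → P β))

  IsSquare : Carrier → Set
  IsSquare x = ∃[ y ] (y * y ≡ x)

{-# OPTIONS --safe #-}
-- Since p ≥ 5, both 2 and 3 are invertible in F. For λ ∉ {0, 1}, j(E_λ) = 0 means
-- Φ₆(λ) = λ² − λ + 1 = 0, so −λ is a primitive cube root of unity and 3 ∣ q − 1, which rules
-- out q ≡ 2 (mod 3). The other root of Φ₆ is 1 − λ. An isomorphism E_β ≅ E_λ multiplies c₄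
-- by u⁴ and c₆ by u⁶; as c₄(E_β) = 16 Φ₆(β), this forces β ∈ {λ, 1 − λ}, and as
-- c₆(E_{1−λ}) = −c₆(E_λ) ≠ 0 (as c₄ = 0 and c₄³ − c₆² = 1728 Δ ≠ 0), the case β = 1 − λ forces
-- (u³)² = −1. Conversely, u = iλ with i² = −1 is an isomorphism E_{1−λ} ≅ E_λ. Since λ³ = −1,
-- λ is a square exactly when −1 is. Finally −1 is a square iff q ≡ 1 (mod 4): a square root
-- of −1 has order 4 in F^×, and without one the Klein group {x, −x, x⁻¹, −x⁻¹} acts freely
-- on F ∖ {0, ±1}.
module Submission where

open import Defs
open import Data.Nat using (ℕ; _≤_; _^_; _%_)
open import Data.Nat.Primality using (Prime)
open import Data.Product using (_×_)
open import Relation.Nullary using (¬_)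
open import Relation.Binary.PropositionalEquality using (_≡_; _≢_)

open import Algebra.Bundles using (CommutativeRing; RawRing; Semiring)
import Algebra.Definitions.RawSemiring as RawSemiringDefinitions
open import Algebra.Properties.CommutativeSemigroup using (interchange)
import Algebra.Properties.Ring
import Algebra.Solver.Ring
import Algebra.Solver.Ring.AlmostCommutativeRing as ACR
open import Data.Fin as Fin using (Fin; toℕ)
import Data.Fin.Properties as Fin
open import Data.Integer as ℤ using (ℤ; -[1+_])
import Data.Integer.Properties as ℤ
open import Data.List using (List; []; _∷_; length; filter; tabulate)
open import Data.List.Properties using (filter-notAll; length-tabulate)
import Data.List.Membership.DecPropositional as DecMembership
open import Data.List.Membership.Propositional using (_∈_; _∉_; lose)
open import Data.List.Membership.Propositional.Properties using (∈-filter⁺; ∈-filter⁻; ∈-tabulate⁺; ∈-tabulate⁻)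
open import Data.List.Relation.Binary.Subset.Propositional using (_⊆_)
open import Data.List.Relation.Unary.All as All using (All; []; _∷_)
import Data.List.Relation.Unary.All.Properties as All
open import Data.List.Relation.Unary.AllPairs using ([]; _∷_)
open import Data.List.Relation.Unary.Any as Any using (here; there; any?)
open import Data.List.Relation.Unary.Unique.Propositional using (Unique)
import Data.List.Relation.Unary.Unique.Propositional.Properties as Unique
import Data.Maybe as Maybe
open import Data.Nat as ℕ using (zero; suc; _<_; _∸_; z≤n; s≤s; NonZero)
import Data.Nat.Properties as ℕ
open import Data.Nat.Divisibility using (_∣_; _∣0; ∣-refl; ∣m∣n⇒∣m+n; divides-refl; ∣1⇒≡1)
open import Data.Nat.DivMod using (_/_; m≡m%n+[m/n]*n; m%n<n; %-remove-+ʳ; m∣n⇒o%n%m≡o%m)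
open import Data.Nat.GeneralisedArithmetic using (fold; fold-+)
open import Data.Nat.Primality using (prime[2]; prime?; euclidsLemma; prime⇒irreducible; ¬prime[1])
open import Data.Product using (∃; _,_; proj₂)
open import Data.Sign as Sign using (Sign)
open import Data.Sum as Sum using (_⊎_; inj₁; inj₂; [_,_]′)
open import Data.Unit using (tt)
open import Function using (_∘_; id)
open import Function.Bundles using (Inverse; _⇔_; mk⇔; Equivalence)
open import Function.Properties.Inverse using (↔⇒↣)
open import Level using (0ℓ)
open import Relation.Binary.Definitions using (DecidableEquality; tri<; tri≈; tri>)
open import Relation.Binary.PropositionalEquality
open import Relation.Nullary using (yes; no; ¬?; contradiction)
open import Relation.Nullary.Decidable using (map′; via-injection; dec⇒maybe; decidable-stable; toWitness)
open import Relation.Unary using (Pred; Decidable; U)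

-- Counting orbits

module OrbitCounting {A : Set} (_≟_ : DecidableEquality A) where
  open DecMembership _≟_ using (_∈?_)

  infixl 5 _∖_
  _∖_ : List A → List A → List A
  xs ∖ S = filter (λ x → ¬? (x ∈? S)) xs

  Unique-⊆⇒length≤ : ∀ {xs ys} → Unique xs → xs ⊆ ys → length xs ≤ length ys
  Unique-⊆⇒length≤ {[]}         _              _        = z≤n
  Unique-⊆⇒length≤ {x ∷ xs} {ys} (x∉xs ∷ xs-unique) x∷xs⊆ys = begin-strict
    length xs              ≤⟨ Unique-⊆⇒length≤ xs-unique xs⊆ys-x ⟩
    length (filter x≢? ys) <⟨ filter-notAll x≢? ys (Any.map (λ x≡y x≢y → x≢y x≡y) (x∷xs⊆ys (here refl))) ⟩
    length ys              ∎
    where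
      open ℕ.≤-Reasoning
      x≢? : Decidable (x ≢_)
      x≢? y = ¬? (x ≟ y)

      xs⊆ys-x : xs ⊆ filter x≢? ys
      xs⊆ys-x y∈xs = ∈-filter⁺ x≢? (x∷xs⊆ys (there y∈xs)) (All.lookup x∉xs y∈xs)

  length-filter+length-filter-¬ : ∀ {P : Pred A 0ℓ} (P? : Decidable P) xs →
    length xs ≡ length (filter P? xs) ℕ.+ length (filter (λ x → ¬? (P? x)) xs)
  length-filter+length-filter-¬ P? []       = refl
  length-filter+length-filter-¬ P? (x ∷ xs) with P? x
  ... | yes _ = cong suc (length-filter+length-filter-¬ P? xs)
  ... | no  _ = trans (cong suc (length-filter+length-filter-¬ P? xs)) (sym (ℕ.+-suc _ _))

  length-∖ : ∀ {S xs} → Unique S → Unique xs → S ⊆ xs → length xs ≡ length S ℕ.+ length (xs ∖ S)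
  length-∖ {S} {xs} S-unique xs-unique S⊆xs =
    trans (length-filter+length-filter-¬ (_∈? S) xs) (cong (ℕ._+ length (xs ∖ S)) length-xs∩S)
    where
      length-xs∩S : length (filter (_∈? S) xs) ≡ length S
      length-xs∩S = ℕ.≤-antisym
        (Unique-⊆⇒length≤ (Unique.filter⁺ (_∈? S) xs-unique) (λ x∈ → proj₂ (∈-filter⁻ (_∈? S) {xs = xs} x∈)))
        (Unique-⊆⇒length≤ S-unique (λ x∈S → ∈-filter⁺ (_∈? S) (S⊆xs x∈S) x∈S))

  record Orbits (D : Pred A 0ℓ) (m : ℕ) : Set where
    field
      orbit        : A → List A
      orbit-unique : ∀ {x} → D x → Unique (orbit x)
      length-orbit : ∀ x → length (orbit x) ≡ m
      ∈-orbit      : ∀ {x} → D x → x ∈ orbit x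
      orbit-sym    : ∀ {x y} → D x → y ∈ orbit x → x ∈ orbit y
      orbit-trans  : ∀ {x y} → D x → y ∈ orbit x → orbit y ⊆ orbit x

    orbit-closed⇒∣length : ∀ {xs} → Unique xs → All D xs → (∀ {x} → x ∈ xs → orbit x ⊆ xs) → m ∣ length xs
    orbit-closed⇒∣length {xs} = go (length xs) ℕ.≤-refl
      where
        go : ∀ n {xs} → length xs ≤ n → Unique xs → All D xs → (∀ {x} → x ∈ xs → orbit x ⊆ xs) → m ∣ length xs
        go _       {[]}     _    _        _     _      = m ∣0
        go (suc n) {x ∷ xs} (s≤s len≤n) unique (Dx ∷ Dxs) closed =
          subst (m ∣_) (sym (trans (length-∖ (orbit-unique Dx) unique (closed (here refl)))
                                   (cong (ℕ._+ length rest) (length-orbit x))))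
                (∣m∣n⇒∣m+n ∣-refl (go n rest-length (Unique.filter⁺ outside-orbit-x? unique)
                                               (All.filter⁺ outside-orbit-x? (Dx ∷ Dxs)) rest-closed))
          where
            outside-orbit-x? : Decidable (_∉ orbit x)
            outside-orbit-x? z = ¬? (z ∈? orbit x)
            rest : List A
            rest = (x ∷ xs) ∖ orbit x
            rest-length : length rest ≤ n
            rest-length = ℕ.≤-pred (ℕ.≤-trans
              (filter-notAll outside-orbit-x? (x ∷ xs) (here (λ x∉ → x∉ (∈-orbit Dx)))) (s≤s len≤n))
            rest-closed : ∀ {y} → y ∈ rest → orbit y ⊆ rest
            rest-closed {y} y∈rest {z} z∈orbit-y with ∈-filter⁻ outside-orbit-x? {xs = x ∷ xs} y∈rest
            ... | y∈x∷xs , y∉orbit-x =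
              ∈-filter⁺ outside-orbit-x? (closed y∈x∷xs z∈orbit-y)
                (λ z∈orbit-x → y∉orbit-x (orbit-trans Dx z∈orbit-x (orbit-sym (All.lookup (Dx ∷ Dxs) y∈x∷xs) z∈orbit-y)))

  module _ {D : Pred A 0ℓ} (σ : A → A) (n : ℕ) .{{_ : NonZero n}}
           (D-σ : ∀ {x} → D x → D (σ x))
           (period : ∀ {x} → D x → fold x σ n ≡ x)
           (aperiodic : ∀ {x i} → D x → 0 < i → i < n → fold x σ i ≢ x) where

    private
      σ^ : ℕ → A → A
      σ^ i x = fold x σ i

      σ^-+ : ∀ i j x → σ^ (i ℕ.+ j) x ≡ σ^ i (σ^ j x)
      σ^-+ i j x = fold-+ x σ i

      D-σ^ : ∀ i {x} → D x → D (σ^ i x)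
      D-σ^ zero    Dx = Dx
      D-σ^ (suc i) Dx = D-σ (D-σ^ i Dx)

      σ^-*n : ∀ k {x} → D x → σ^ (k ℕ.* n) x ≡ x
      σ^-*n zero    Dx = refl
      σ^-*n (suc k) {x} Dx = begin
        σ^ (n ℕ.+ k ℕ.* n) x ≡⟨ σ^-+ n (k ℕ.* n) x ⟩
        σ^ n (σ^ (k ℕ.* n) x) ≡⟨ cong (σ^ n) (σ^-*n k Dx) ⟩
        σ^ n x                ≡⟨ period Dx ⟩
        x                     ∎
        where open ≡-Reasoning

      σ^-% : ∀ i {x} → D x → σ^ i x ≡ σ^ (i % n) x
      σ^-% i {x} Dx = begin
        σ^ i x                              ≡⟨ cong (λ j → σ^ j x) (m≡m%n+[m/n]*n i n) ⟩
        σ^ (i % n ℕ.+ i / n ℕ.* n) x        ≡⟨ σ^-+ (i % n) (i / n ℕ.* n) x ⟩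
        σ^ (i % n) (σ^ (i / n ℕ.* n) x)     ≡⟨ cong (σ^ (i % n)) (σ^-*n (i / n) Dx) ⟩
        σ^ (i % n) x                        ∎
        where open ≡-Reasoning

      orbit : A → List A
      orbit x = tabulate (λ (i : Fin n) → σ^ (toℕ i) x)

      σ^-∈-orbit : ∀ i {x} → D x → σ^ i x ∈ orbit x
      σ^-∈-orbit i {x} Dx = subst (_∈ orbit x)
        (trans (cong (λ j → σ^ j x) (Fin.toℕ-fromℕ< (m%n<n i n))) (sym (σ^-% i Dx)))
        (∈-tabulate⁺ (Fin.fromℕ< (m%n<n i n)))

      σ^-injective : ∀ {x i j} → D x → i < j → j < n → σ^ i x ≢ σ^ j x
      σ^-injective {x} {i} {j} Dx i<j j<n σⁱx≡σʲx = aperiodic (D-σ^ i Dx) (ℕ.m<n⇒0<n∸m i<j)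
        (ℕ.≤-<-trans (ℕ.m∸n≤m j i) j<n)
        (begin
          σ^ (j ∸ i) (σ^ i x) ≡⟨ sym (σ^-+ (j ∸ i) i x) ⟩
          σ^ (j ∸ i ℕ.+ i) x  ≡⟨ cong (λ k → σ^ k x) (ℕ.m∸n+n≡m (ℕ.<⇒≤ i<j)) ⟩
          σ^ j x              ≡⟨ sym σⁱx≡σʲx ⟩
          σ^ i x              ∎)
        where open ≡-Reasoning

    cyclicOrbits : Orbits D n
    cyclicOrbits = record
      { orbit        = orbit
      ; orbit-unique = λ Dx → Unique.tabulate⁺ (λ {i} {j} → index-injective Dx i j)
      ; length-orbit = λ x → length-tabulate _
      ; ∈-orbit      = σ^-∈-orbit 0
      ; orbit-sym    = orbit-sym
      ; orbit-trans  = orbit-trans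
      }
      where
        orbit-sym : ∀ {x y} → D x → y ∈ orbit x → x ∈ orbit y
        orbit-sym {x} Dx y∈orbit-x with ∈-tabulate⁻ y∈orbit-x
        ... | i , refl = subst (_∈ orbit (σ^ (toℕ i) x)) σ^[n-i]σ^i≡id (σ^-∈-orbit (n ∸ toℕ i) (D-σ^ (toℕ i) Dx))
          where
            open ≡-Reasoning
            σ^[n-i]σ^i≡id : σ^ (n ∸ toℕ i) (σ^ (toℕ i) x) ≡ x
            σ^[n-i]σ^i≡id = begin
              σ^ (n ∸ toℕ i) (σ^ (toℕ i) x) ≡⟨ sym (σ^-+ (n ∸ toℕ i) (toℕ i) x) ⟩
              σ^ (n ∸ toℕ i ℕ.+ toℕ i) x    ≡⟨ cong (λ k → σ^ k x) (ℕ.m∸n+n≡m (ℕ.<⇒≤ (Fin.toℕ<n i))) ⟩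
              σ^ n x                        ≡⟨ period Dx ⟩
              x                             ∎

        orbit-trans : ∀ {x y} → D x → y ∈ orbit x → orbit y ⊆ orbit x
        orbit-trans {x} Dx y∈orbit-x z∈orbit-y with ∈-tabulate⁻ y∈orbit-x
        ... | i , refl with ∈-tabulate⁻ z∈orbit-y
        ... | j , refl = subst (_∈ orbit x) (σ^-+ (toℕ j) (toℕ i) x) (σ^-∈-orbit (toℕ j ℕ.+ toℕ i) Dx)

        index-injective : ∀ {x} → D x → ∀ (i j : Fin n) → σ^ (toℕ i) x ≡ σ^ (toℕ j) x → i ≡ j
        index-injective Dx i j eq with ℕ.<-cmp (toℕ i) (toℕ j)
        ... | tri< i<j _ _ = contradiction eq (σ^-injective Dx i<j (Fin.toℕ<n j))
        ... | tri≈ _ i≡j _ = Fin.toℕ-injective i≡j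
        ... | tri> _ _ j<i = contradiction (sym eq) (σ^-injective Dx j<i (Fin.toℕ<n i))

    σ-closed⇒∣length : ∀ {xs} → Unique xs → All D xs → (∀ {x} → x ∈ xs → σ x ∈ xs) → n ∣ length xs
    σ-closed⇒∣length {xs} unique Dxs σ-closed = Orbits.orbit-closed⇒∣length cyclicOrbits unique Dxs orbit-closed
      where
        σ^-closed : ∀ i {x} → x ∈ xs → σ^ i x ∈ xs
        σ^-closed zero    x∈xs = x∈xs
        σ^-closed (suc i) x∈xs = σ-closed (σ^-closed i x∈xs)

        orbit-closed : ∀ {x} → x ∈ xs → orbit x ⊆ xs
        orbit-closed x∈xs y∈orbit-x with ∈-tabulate⁻ y∈orbit-x
        ... | i , refl = σ^-closed (toℕ i) x∈xs

  module _ {D : Pred A 0ℓ} (ν ι : A → A)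
           (D-ν : ∀ {x} → D x → D (ν x)) (D-ι : ∀ {x} → D x → D (ι x))
           (ν-involutive : ∀ {x} → D x → ν (ν x) ≡ x) (ι-involutive : ∀ {x} → D x → ι (ι x) ≡ x)
           (ν∘ι≡ι∘ν : ∀ {x} → D x → ν (ι x) ≡ ι (ν x))
           (x≢νx : ∀ {x} → D x → x ≢ ν x) (x≢ιx : ∀ {x} → D x → x ≢ ι x)
           (x≢νιx : ∀ {x} → D x → x ≢ ν (ι x)) where

    private
      orbit : A → List A
      orbit x = x ∷ ν x ∷ ι x ∷ ν (ι x) ∷ []

      ν-injective : ∀ {x y} → D x → D y → ν x ≡ ν y → x ≡ y
      ν-injective {x} {y} Dx Dy νx≡νy = trans (sym (ν-involutive Dx)) (trans (cong ν νx≡νy) (ν-involutive Dy))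

      νιν≡ι : ∀ {x} → D x → ν (ι (ν x)) ≡ ι x
      νιν≡ι {x} Dx = trans (cong ν (sym (ν∘ι≡ι∘ν Dx))) (ν-involutive (D-ι Dx))

      orbit-unique : ∀ {x} → D x → Unique (orbit x)
      orbit-unique {x} Dx =
          (x≢νx Dx ∷ x≢ιx Dx ∷ x≢νιx Dx ∷ [])
        ∷ ((λ νx≡ιx → x≢νιx Dx (trans (sym (ν-involutive Dx)) (cong ν νx≡ιx)))
          ∷ (λ νx≡νιx → x≢ιx Dx (ν-injective Dx (D-ι Dx) νx≡νιx)) ∷ [])
        ∷ (x≢νx (D-ι Dx) ∷ [])
        ∷ [] ∷ []

      orbit-ν⊆ : ∀ {x} → D x → orbit (ν x) ⊆ orbit x
      orbit-ν⊆ Dx (here refl)                         = there (here refl)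
      orbit-ν⊆ Dx (there (here refl))                 = here (ν-involutive Dx)
      orbit-ν⊆ Dx (there (there (here refl)))         = there (there (there (here (sym (ν∘ι≡ι∘ν Dx)))))
      orbit-ν⊆ Dx (there (there (there (here refl)))) = there (there (here (νιν≡ι Dx)))

      orbit-ι⊆ : ∀ {x} → D x → orbit (ι x) ⊆ orbit x
      orbit-ι⊆ Dx (here refl)                         = there (there (here refl))
      orbit-ι⊆ Dx (there (here refl))                 = there (there (there (here refl)))
      orbit-ι⊆ Dx (there (there (here refl)))         = here (ι-involutive Dx)
      orbit-ι⊆ Dx (there (there (there (here refl)))) = there (here (cong ν (ι-involutive Dx)))

      orbit-trans : ∀ {x y} → D x → y ∈ orbit x → orbit y ⊆ orbit x
      orbit-trans Dx (here refl)                         = λ z∈ → z∈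
      orbit-trans Dx (there (here refl))                 = orbit-ν⊆ Dx
      orbit-trans Dx (there (there (here refl)))         = orbit-ι⊆ Dx
      orbit-trans Dx (there (there (there (here refl)))) = λ z∈ → orbit-ι⊆ Dx (orbit-ν⊆ (D-ι Dx) z∈)

      orbit-sym : ∀ {x y} → D x → y ∈ orbit x → x ∈ orbit y
      orbit-sym Dx (here refl)                         = here refl
      orbit-sym Dx (there (here refl))                 = there (here (sym (ν-involutive Dx)))
      orbit-sym Dx (there (there (here refl)))         = there (there (here (sym (ι-involutive Dx))))
      orbit-sym Dx (there (there (there (here refl)))) =
        there (there (there (here (sym (trans (νιν≡ι (D-ι Dx)) (ι-involutive Dx))))))

    kleinOrbits : Orbits D 4
    kleinOrbits = record
      { orbit        = orbit
      ; orbit-unique = orbit-unique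
      ; length-orbit = λ _ → refl
      ; ∈-orbit      = λ _ → here refl
      ; orbit-sym    = orbit-sym
      ; orbit-trans  = orbit-trans
      }

    ν-ι-closed⇒4∣length : ∀ {xs} → Unique xs → All D xs →
      (∀ {x} → x ∈ xs → ν x ∈ xs) → (∀ {x} → x ∈ xs → ι x ∈ xs) → 4 ∣ length xs
    ν-ι-closed⇒4∣length {xs} unique Dxs ν-closed ι-closed = Orbits.orbit-closed⇒∣length kleinOrbits unique Dxs orbit-closed
      where
        orbit-closed : ∀ {x} → x ∈ xs → orbit x ⊆ xs
        orbit-closed x∈xs (here refl)                         = x∈xs
        orbit-closed x∈xs (there (here refl))                 = ν-closed x∈xs
        orbit-closed x∈xs (there (there (here refl)))         = ι-closed x∈xs
        orbit-closed x∈xs (there (there (there (here refl)))) = ν-closed (ι-closed x∈xs)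

-- Field arithmetic and the ring solver

module FieldArithmetic (F : FiniteField) where
  open FF F

  commutativeRing : CommutativeRing _ _
  commutativeRing = record { isCommutativeRing = isCommutativeRing }

  open CommutativeRing commutativeRing public
    using (+-assoc; +-comm; +-identityˡ; +-identityʳ; -‿inverseˡ; -‿inverseʳ;
           *-assoc; *-comm; *-identityˡ; *-identityʳ; distribʳ; zeroˡ; zeroʳ; +-commutativeSemigroup)
  open Algebra.Properties.Ring (CommutativeRing.ring commutativeRing) public

  fromℕ-+ : ∀ m n → fromℕ (m ℕ.+ n) ≡ fromℕ m + fromℕ n
  fromℕ-+ zero    n = sym (+-identityˡ _)
  fromℕ-+ (suc m) n = trans (cong (1# +_) (fromℕ-+ m n)) (sym (+-assoc _ _ _))

  fromℕ-* : ∀ m n → fromℕ (m ℕ.* n) ≡ fromℕ m * fromℕ n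
  fromℕ-* zero    n = sym (zeroˡ _)
  fromℕ-* (suc m) n = begin
    fromℕ (n ℕ.+ m ℕ.* n)            ≡⟨ fromℕ-+ n (m ℕ.* n) ⟩
    fromℕ n + fromℕ (m ℕ.* n)        ≡⟨ cong₂ _+_ (sym (*-identityˡ _)) (fromℕ-* m n) ⟩
    1# * fromℕ n + fromℕ m * fromℕ n ≡⟨ sym (distribʳ _ _ _) ⟩
    fromℕ (suc m) * fromℕ n          ∎
    where open ≡-Reasoning

  fromℤ : ℤ → Carrier
  fromℤ (ℤ.+ n)  = fromℕ n
  fromℤ -[1+ n ] = - fromℕ (suc n)

  fromℤ-⊖ : ∀ m n → fromℤ (m ℤ.⊖ n) ≡ fromℕ m - fromℕ n
  fromℤ-⊖ zero    zero    = sym (-‿inverseʳ 0#)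
  fromℤ-⊖ zero    (suc n) = sym (+-identityˡ _)
  fromℤ-⊖ (suc m) zero    = sym (trans (cong (fromℕ (suc m) +_) -0#≈0#) (+-identityʳ _))
  fromℤ-⊖ (suc m) (suc n) = begin
    fromℤ (suc m ℤ.⊖ suc n)           ≡⟨ cong fromℤ (ℤ.[1+m]⊖[1+n]≡m⊖n m n) ⟩
    fromℤ (m ℤ.⊖ n)                   ≡⟨ fromℤ-⊖ m n ⟩
    fromℕ m - fromℕ n                 ≡⟨ sym (+-identityˡ _) ⟩
    0# + (fromℕ m - fromℕ n)          ≡⟨ cong (_+ (fromℕ m - fromℕ n)) (sym (-‿inverseʳ 1#)) ⟩
    (1# - 1#) + (fromℕ m - fromℕ n)   ≡⟨ interchange +-commutativeSemigroup 1# (- 1#) (fromℕ m) (- fromℕ n) ⟩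
    (1# + fromℕ m) + (- 1# - fromℕ n) ≡⟨ cong ((1# + fromℕ m) +_) (-‿+-comm 1# (fromℕ n)) ⟩
    (1# + fromℕ m) - (1# + fromℕ n)   ∎
    where open ≡-Reasoning

  fromℤ-+ : ∀ i j → fromℤ (i ℤ.+ j) ≡ fromℤ i + fromℤ j
  fromℤ-+ (ℤ.+ m)  (ℤ.+ n)  = fromℕ-+ m n
  fromℤ-+ (ℤ.+ m)  -[1+ n ] = fromℤ-⊖ m (suc n)
  fromℤ-+ -[1+ m ] (ℤ.+ n)  = trans (fromℤ-⊖ n (suc m)) (+-comm _ _)
  fromℤ-+ -[1+ m ] -[1+ n ] = begin
    - fromℕ (suc (suc (m ℕ.+ n)))     ≡⟨ cong (λ k → - fromℕ k) (sym (ℕ.+-suc (suc m) n)) ⟩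
    - fromℕ (suc m ℕ.+ suc n)         ≡⟨ cong -_ (fromℕ-+ (suc m) (suc n)) ⟩
    - (fromℕ (suc m) + fromℕ (suc n)) ≡⟨ sym (-‿+-comm _ _) ⟩
    - fromℕ (suc m) - fromℕ (suc n)   ∎
    where open ≡-Reasoning

  fromℤ-neg : ∀ i → fromℤ (ℤ.- i) ≡ - fromℤ i
  fromℤ-neg (ℤ.+ zero)  = sym -0#≈0#
  fromℤ-neg (ℤ.+ suc n) = refl
  fromℤ-neg -[1+ n ]    = sym (-‿involutive _)

  signed : Sign → Carrier → Carrier
  signed Sign.+ x = x
  signed Sign.- x = - x

  fromℤ-◃ : ∀ s n → fromℤ (s ℤ.◃ n) ≡ signed s (fromℕ n)
  fromℤ-◃ Sign.+ zero    = refl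
  fromℤ-◃ Sign.- zero    = sym -0#≈0#
  fromℤ-◃ Sign.+ (suc n) = refl
  fromℤ-◃ Sign.- (suc n) = refl

  fromℤ-sign-abs : ∀ i → fromℤ i ≡ signed (ℤ.sign i) (fromℕ ℤ.∣ i ∣)
  fromℤ-sign-abs (ℤ.+ n)  = refl
  fromℤ-sign-abs -[1+ n ] = refl

  signed-* : ∀ s t x y → signed (s Sign.* t) (x * y) ≡ signed s x * signed t y
  signed-* Sign.+ Sign.+ x y = refl
  signed-* Sign.+ Sign.- x y = -‿distribʳ-* x y
  signed-* Sign.- Sign.+ x y = -‿distribˡ-* x y
  signed-* Sign.- Sign.- x y = begin
    x * y         ≡⟨ sym (-‿involutive _) ⟩
    - - (x * y)   ≡⟨ cong -_ (-‿distribʳ-* x y) ⟩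
    - (x * - y)   ≡⟨ -‿distribˡ-* x (- y) ⟩
    - x * - y     ∎
    where open ≡-Reasoning

  fromℤ-* : ∀ i j → fromℤ (i ℤ.* j) ≡ fromℤ i * fromℤ j
  fromℤ-* i j = begin
    fromℤ (i ℤ.* j)                   ≡⟨ fromℤ-◃ (s Sign.* t) (∣i∣ ℕ.* ∣j∣) ⟩
    signed (s Sign.* t) (fromℕ (∣i∣ ℕ.* ∣j∣)) ≡⟨ cong (signed (s Sign.* t)) (fromℕ-* ∣i∣ ∣j∣) ⟩
    signed (s Sign.* t) (fromℕ ∣i∣ * fromℕ ∣j∣) ≡⟨ signed-* s t _ _ ⟩
    signed s (fromℕ ∣i∣) * signed t (fromℕ ∣j∣) ≡⟨ sym (cong₂ _*_ (fromℤ-sign-abs i) (fromℤ-sign-abs j)) ⟩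
    fromℤ i * fromℤ j                 ∎
    where
      open ≡-Reasoning
      s t : Sign
      s = ℤ.sign i
      t = ℤ.sign j
      ∣i∣ ∣j∣ : ℕ
      ∣i∣ = ℤ.∣ i ∣
      ∣j∣ = ℤ.∣ j ∣

  -- The solver reads its constant 1 through this interpretation, so it has to be 1# itself
  -- rather than fromℕ 1 = 1# + 0#; otherwise no goal mentioning 1# could be matched.
  fromℕ⁺ : ℕ → Carrier
  fromℕ⁺ 1 = 1#
  fromℕ⁺ n = fromℕ n

  fromℤ⁺ : ℤ → Carrier
  fromℤ⁺ (ℤ.+ n)  = fromℕ⁺ n
  fromℤ⁺ -[1+ n ] = - fromℕ⁺ (suc n)

  fromℤ⁺≡fromℤ : ∀ i → fromℤ⁺ i ≡ fromℤ i
  fromℤ⁺≡fromℤ (ℤ.+ 0)           = refl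
  fromℤ⁺≡fromℤ (ℤ.+ 1)           = sym (+-identityʳ 1#)
  fromℤ⁺≡fromℤ (ℤ.+ suc (suc n)) = refl
  fromℤ⁺≡fromℤ -[1+ 0 ]          = cong -_ (sym (+-identityʳ 1#))
  fromℤ⁺≡fromℤ -[1+ suc n ]      = refl

  ℤ⟶Carrier : ℤ.+-*-rawRing ACR.-Raw-AlmostCommutative⟶ ACR.fromCommutativeRing commutativeRing
  ℤ⟶Carrier = record
    { ⟦_⟧    = fromℤ⁺
    ; +-homo = homo₂ ℤ._+_ _+_ fromℤ-+
    ; *-homo = homo₂ ℤ._*_ _*_ fromℤ-*
    ; -‿homo = λ i → trans (fromℤ⁺≡fromℤ (ℤ.- i)) (trans (fromℤ-neg i) (cong -_ (sym (fromℤ⁺≡fromℤ i))))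
    ; 0-homo = refl
    ; 1-homo = refl
    }
    where
      homo₂ : ∀ (_∘_ : ℤ → ℤ → ℤ) (_∙_ : Carrier → Carrier → Carrier) →
              (∀ i j → fromℤ (i ∘ j) ≡ fromℤ i ∙ fromℤ j) →
              ∀ i j → fromℤ⁺ (i ∘ j) ≡ fromℤ⁺ i ∙ fromℤ⁺ j
      homo₂ _∘_ _∙_ homo i j =
        trans (fromℤ⁺≡fromℤ (i ∘ j)) (trans (homo i j) (sym (cong₂ _∙_ (fromℤ⁺≡fromℤ i) (fromℤ⁺≡fromℤ j))))

  open Algebra.Solver.Ring ℤ.+-*-rawRing (ACR.fromCommutativeRing commutativeRing) ℤ⟶Carrier
    (λ i j → Maybe.map (cong fromℤ⁺) (dec⇒maybe (i ℤ.≟ j))) public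

  κ : ∀ {n} → ℕ → Polynomial n
  κ k = con (ℤ.+ k)

  polynomialRawRing : ℕ → RawRing 0ℓ 0ℓ
  polynomialRawRing n = record
    { Carrier = Polynomial n ; _≈_ = _≡_ ; _+_ = _:+_ ; _*_ = _:*_ ; -_ = :-_ ; 0# = κ 0 ; 1# = κ 1 }

  infix 4 _≟_
  _≟_ : DecidableEquality Carrier
  _≟_ = via-injection (↔⇒↣ enum) Fin._≟_

  ≡-modulo : ∀ {a b h} c → a ≡ b + c * h → h ≡ 0# → a ≡ b
  ≡-modulo {a} {b} c a≡b+ch refl = trans a≡b+ch (solve 2 (λ b c → b :+ c :* κ 0 := b) refl b c)

  x*y≡0⇒x≡0⊎y≡0 : ∀ {x y} → x * y ≡ 0# → x ≡ 0# ⊎ y ≡ 0#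
  x*y≡0⇒x≡0⊎y≡0 {x} {y} xy≡0 with x ≟ 0#
  ... | yes x≡0 = inj₁ x≡0
  ... | no  x≢0 = inj₂ (begin
    y                ≡⟨ solve 1 (λ y → y := κ 1 :* y) refl y ⟩
    1# * y           ≡⟨ cong (_* y) (sym (⁻¹-inverse x x≢0)) ⟩
    (x * x ⁻¹) * y   ≡⟨ solve 3 (λ x x⁻¹ y → (x :* x⁻¹) :* y := x⁻¹ :* (x :* y)) refl x (x ⁻¹) y ⟩
    x ⁻¹ * (x * y)   ≡⟨ cong (x ⁻¹ *_) xy≡0 ⟩
    x ⁻¹ * 0#        ≡⟨ zeroʳ _ ⟩
    0#               ∎)
    where open ≡-Reasoning

  *-≢0 : ∀ {x y} → x ≢ 0# → y ≢ 0# → x * y ≢ 0#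
  *-≢0 x≢0 y≢0 xy≡0 = [ x≢0 , y≢0 ]′ (x*y≡0⇒x≡0⊎y≡0 xy≡0)

  *-cancelʳ-≢0 : ∀ {a b x} → x ≢ 0# → a * x ≡ b * x → a ≡ b
  *-cancelʳ-≢0 {a} {b} {x} x≢0 ax≡bx =
    [ x∙y⁻¹≈ε⇒x≈y a b , (λ x≡0 → contradiction x≡0 x≢0) ]′ (x*y≡0⇒x≡0⊎y≡0 (begin
      (a - b) * x   ≡⟨ solve 3 (λ a b x → (a :- b) :* x := a :* x :- b :* x) refl a b x ⟩
      a * x - b * x ≡⟨ x≈y⇒x∙y⁻¹≈ε ax≡bx ⟩
      0#            ∎))
    where open ≡-Reasoning

  -‿≢0 : ∀ {x} → x ≢ 0# → - x ≢ 0#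
  -‿≢0 {x} x≢0 -x≡0 = x≢0 (trans (sym (-‿involutive x)) (trans (cong -_ -x≡0) -0#≈0#))

  ⁻¹-unique : ∀ {x y} → x * y ≡ 1# → x ⁻¹ ≡ y
  ⁻¹-unique {x} {y} xy≡1 =
    *-cancelʳ-≢0 x≢0 (trans (*-comm _ x) (trans (⁻¹-inverse x x≢0) (trans (sym xy≡1) (*-comm x y))))
    where
      x≢0 : x ≢ 0#
      x≢0 x≡0 = 0≢1 (trans (sym (zeroˡ y)) (trans (cong (_* y) (sym x≡0)) xy≡1))

  ⁻¹-≢0 : ∀ {x} → x ≢ 0# → x ⁻¹ ≢ 0#
  ⁻¹-≢0 {x} x≢0 x⁻¹≡0 = 0≢1 (trans (sym (zeroʳ x)) (trans (cong (x *_) (sym x⁻¹≡0)) (⁻¹-inverse x x≢0)))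

  ⁻¹-involutive : ∀ {x} → x ≢ 0# → x ⁻¹ ⁻¹ ≡ x
  ⁻¹-involutive {x} x≢0 = ⁻¹-unique (trans (*-comm _ x) (⁻¹-inverse x x≢0))

  -‿⁻¹-comm : ∀ {x} → x ≢ 0# → - (x ⁻¹) ≡ (- x) ⁻¹
  -‿⁻¹-comm {x} x≢0 = sym (⁻¹-unique
    (trans (solve 2 (λ x x⁻¹ → :- x :* :- x⁻¹ := x :* x⁻¹) refl x (x ⁻¹)) (⁻¹-inverse x x≢0)))

  x²≡1⇒x≡±1 : ∀ {x} → x * x ≡ 1# → x ≡ 1# ⊎ x ≡ - 1#
  x²≡1⇒x≡±1 {x} x²≡1 =
    Sum.map (x∙y⁻¹≈ε⇒x≈y x 1#) (x∙y⁻¹≈ε⇒x≈y x (- 1#)) (x*y≡0⇒x≡0⊎y≡0 (begin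
    (x - 1#) * (x - - 1#) ≡⟨ solve 1 (λ x → (x :- κ 1) :* (x :- :- κ 1) := x :* x :- κ 1) refl x ⟩
    x * x - 1#            ≡⟨ x≈y⇒x∙y⁻¹≈ε x²≡1 ⟩
    0#                    ∎))
    where open ≡-Reasoning

  fromℕ-1≢0 : fromℕ 1 ≢ 0#
  fromℕ-1≢0 1+0≡0 = 0≢1 (trans (sym 1+0≡0) (+-identityʳ 1#))

  fromℕ-*-≢0 : ∀ m n → fromℕ m ≢ 0# → fromℕ n ≢ 0# → fromℕ (m ℕ.* n) ≢ 0#
  fromℕ-*-≢0 m n m≢0 n≢0 = subst (_≢ 0#) (sym (fromℕ-* m n)) (*-≢0 m≢0 n≢0)

  fromℕ-^-≢0 : ∀ m k → fromℕ m ≢ 0# → fromℕ (m ℕ.^ k) ≢ 0#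
  fromℕ-^-≢0 m zero    _   = fromℕ-1≢0
  fromℕ-^-≢0 m (suc k) m≢0 = fromℕ-*-≢0 m (m ℕ.^ k) m≢0 (fromℕ-^-≢0 m k m≢0)

  x*y≡0⇒y≡0 : ∀ {x y} → x ≢ 0# → x * y ≡ 0# → y ≡ 0#
  x*y≡0⇒y≡0 x≢0 xy≡0 = [ (λ x≡0 → contradiction x≡0 x≢0) , (λ y≡0 → y≡0) ]′ (x*y≡0⇒x≡0⊎y≡0 xy≡0)

  1≢-1 : fromℕ 2 ≢ 0# → 1# ≢ - 1#
  1≢-1 2≢0 1≡-1 = 2≢0 (begin
    fromℕ 2     ≡⟨ solve 0 (κ 2 := κ 1 :+ κ 1) refl ⟩
    1# + 1#     ≡⟨ cong (1# +_) 1≡-1 ⟩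
    1# + - 1#   ≡⟨ -‿inverseʳ 1# ⟩
    0#          ∎)
    where open ≡-Reasoning

  x≢-x : ∀ {x} → fromℕ 2 ≢ 0# → x ≢ 0# → x ≢ - x
  x≢-x {x} 2≢0 x≢0 x≡-x = *-≢0 2≢0 x≢0 (begin
    fromℕ 2 * x ≡⟨ solve 1 (λ x → κ 2 :* x := x :+ x) refl x ⟩
    x + x       ≡⟨ cong (x +_) x≡-x ⟩
    x + - x     ≡⟨ -‿inverseʳ x ⟩
    0#          ∎)
    where open ≡-Reasoning

-- Weierstrass invariants

-- The quantities b₂, …, Δ of Silverman, III.1, written over an arbitrary raw ring so that the
-- same formulas give both the field-valued invariants and their ring-solver syntax.
module WeierstrassFormulas (R : RawRing 0ℓ 0ℓ) (n̂ : ℕ → RawRing.Carrier R) where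
  open RawRing R

  private
    infixl 6 _-_
    _-_ : Carrier → Carrier → Carrier
    x - y = x + - y

  b₂ b₄ b₆ b₈ c₄ c₆ Δ : Carrier → Carrier → Carrier → Carrier → Carrier → Carrier
  b₂ a1 a2 a3 a4 a6 = a1 * a1 + n̂ 4 * a2
  b₄ a1 a2 a3 a4 a6 = n̂ 2 * a4 + a1 * a3
  b₆ a1 a2 a3 a4 a6 = a3 * a3 + n̂ 4 * a6
  b₈ a1 a2 a3 a4 a6 = a1 * a1 * a6 + n̂ 4 * a2 * a6 - a1 * a3 * a4 + a2 * a3 * a3 - a4 * a4
  c₄ a1 a2 a3 a4 a6 = B₂ * B₂ - n̂ 24 * b₄ a1 a2 a3 a4 a6
    where
      B₂ : Carrier
      B₂ = b₂ a1 a2 a3 a4 a6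
  c₆ a1 a2 a3 a4 a6 = - (B₂ * B₂ * B₂) + n̂ 36 * B₂ * b₄ a1 a2 a3 a4 a6 - n̂ 216 * b₆ a1 a2 a3 a4 a6
    where
      B₂ : Carrier
      B₂ = b₂ a1 a2 a3 a4 a6
  Δ a1 a2 a3 a4 a6 =
    - (B₂ * B₂ * b₈ a1 a2 a3 a4 a6) - n̂ 8 * (B₄ * B₄ * B₄) - n̂ 27 * (B₆ * B₆) + n̂ 9 * B₂ * B₄ * B₆
    where
      B₂ B₄ B₆ : Carrier
      B₂ = b₂ a1 a2 a3 a4 a6
      B₄ = b₄ a1 a2 a3 a4 a6
      B₆ = b₆ a1 a2 a3 a4 a6

module WeierstrassInvariants (F : FiniteField) where
  open FF F
  open FieldArithmetic F
  private
    module Invariant = WeierstrassFormulas (CommutativeRing.rawRing commutativeRing) fromℕ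
  module Syntax {n} = WeierstrassFormulas (polynomialRawRing n) κ

  c₄ c₆ Δ : Weierstrass → Carrier
  c₄ (mkW a1 a2 a3 a4 a6) = Invariant.c₄ a1 a2 a3 a4 a6
  c₆ (mkW a1 a2 a3 a4 a6) = Invariant.c₆ a1 a2 a3 a4 a6
  Δ  (mkW a1 a2 a3 a4 a6) = Invariant.Δ a1 a2 a3 a4 a6

  c₄³-c₆²≡1728Δ : ∀ E → c₄ E * c₄ E * c₄ E - c₆ E * c₆ E ≡ fromℕ 1728 * Δ E
  c₄³-c₆²≡1728Δ (mkW a1 a2 a3 a4 a6) = solve 5 (λ a1 a2 a3 a4 a6 →
    let C₄ : Polynomial 5
        C₄ = Syntax.c₄ a1 a2 a3 a4 a6
        C₆ : Polynomial 5
        C₆ = Syntax.c₆ a1 a2 a3 a4 a6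
    in C₄ :* C₄ :* C₄ :- C₆ :* C₆ := κ 1728 :* Syntax.Δ a1 a2 a3 a4 a6) refl a1 a2 a3 a4 a6

  scale : Carrier → Weierstrass → Weierstrass
  scale u (mkW a1 a2 a3 a4 a6) = mkW (u * a1) (u * u * a2) (u * u * u * a3) (u * u * u * u * a4) (u * u * u * u * u * u * a6)

  shift : Carrier → Carrier → Carrier → Weierstrass → Weierstrass
  shift r s t (mkW a1 a2 a3 a4 a6) = mkW
    (a1 + fromℕ 2 * s)
    (a2 - s * a1 + fromℕ 3 * r - s * s)
    (a3 + r * a1 + fromℕ 2 * t)
    (a4 - s * a3 + fromℕ 2 * r * a2 - (t + r * s) * a1 + fromℕ 3 * r * r - fromℕ 2 * s * t)
    (a6 + r * a4 + r * r * a2 + r * r * r - t * a3 - t * t - r * t * a1)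

  mkW-cong : ∀ {a1 a2 a3 a4 a6 b1 b2 b3 b4 b6} → a1 ≡ b1 → a2 ≡ b2 → a3 ≡ b3 → a4 ≡ b4 → a6 ≡ b6 →
             mkW a1 a2 a3 a4 a6 ≡ mkW b1 b2 b3 b4 b6
  mkW-cong refl refl refl refl refl = refl

  ≅⇒scale≡shift : ∀ {E E′} → E ≅ E′ →
    ∃ λ u → ∃ λ r → ∃ λ s → ∃ λ t → u ≢ 0# × scale u E′ ≡ shift r s t E
  ≅⇒scale≡shift {mkW _ _ _ _ _} {mkW _ _ _ _ _} (u , r , s , t , u≢0 , e1 , e2 , e3 , e4 , e6) =
    u , r , s , t , u≢0 , mkW-cong e1 e2 e3 e4 e6

  scale≡shift⇒≅ : ∀ {E E′ u r s t} → u ≢ 0# → scale u E′ ≡ shift r s t E → E ≅ E′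
  scale≡shift⇒≅ {mkW _ _ _ _ _} {mkW _ _ _ _ _} {u} {r} {s} {t} u≢0 eq =
    u , r , s , t , u≢0 , cong a1 eq , cong a2 eq , cong a3 eq , cong a4 eq , cong a6 eq
    where open Weierstrass

  c₄-scale : ∀ u E → c₄ (scale u E) ≡ u * u * u * u * c₄ E
  c₄-scale u (mkW a1 a2 a3 a4 a6) = solve 6 (λ u a1 a2 a3 a4 a6 →
    Syntax.c₄ (u :* a1) (u :* u :* a2) (u :* u :* u :* a3) (u :* u :* u :* u :* a4) (u :* u :* u :* u :* u :* u :* a6)
      := u :* u :* u :* u :* Syntax.c₄ a1 a2 a3 a4 a6) refl u a1 a2 a3 a4 a6

  c₆-scale : ∀ u E → c₆ (scale u E) ≡ u * u * u * u * u * u * c₆ E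
  c₆-scale u (mkW a1 a2 a3 a4 a6) = solve 6 (λ u a1 a2 a3 a4 a6 →
    Syntax.c₆ (u :* a1) (u :* u :* a2) (u :* u :* u :* a3) (u :* u :* u :* u :* a4) (u :* u :* u :* u :* u :* u :* a6)
      := u :* u :* u :* u :* u :* u :* Syntax.c₆ a1 a2 a3 a4 a6) refl u a1 a2 a3 a4 a6

  c₄-shift : ∀ r s t E → c₄ (shift r s t E) ≡ c₄ E
  c₄-shift r s t (mkW a1 a2 a3 a4 a6) = solve 8 (λ r s t a1 a2 a3 a4 a6 →
    Syntax.c₄ (a1 :+ κ 2 :* s) (a2 :- s :* a1 :+ κ 3 :* r :- s :* s) (a3 :+ r :* a1 :+ κ 2 :* t)
          (a4 :- s :* a3 :+ κ 2 :* r :* a2 :- (t :+ r :* s) :* a1 :+ κ 3 :* r :* r :- κ 2 :* s :* t)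
          (a6 :+ r :* a4 :+ r :* r :* a2 :+ r :* r :* r :- t :* a3 :- t :* t :- r :* t :* a1)
      := Syntax.c₄ a1 a2 a3 a4 a6) refl r s t a1 a2 a3 a4 a6

  c₆-shift : ∀ r s t E → c₆ (shift r s t E) ≡ c₆ E
  c₆-shift r s t (mkW a1 a2 a3 a4 a6) = solve 8 (λ r s t a1 a2 a3 a4 a6 →
    Syntax.c₆ (a1 :+ κ 2 :* s) (a2 :- s :* a1 :+ κ 3 :* r :- s :* s) (a3 :+ r :* a1 :+ κ 2 :* t)
          (a4 :- s :* a3 :+ κ 2 :* r :* a2 :- (t :+ r :* s) :* a1 :+ κ 3 :* r :* r :- κ 2 :* s :* t)
          (a6 :+ r :* a4 :+ r :* r :* a2 :+ r :* r :* r :- t :* a3 :- t :* t :- r :* t :* a1)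
      := Syntax.c₆ a1 a2 a3 a4 a6) refl r s t a1 a2 a3 a4 a6

  ≅⇒c₄c₆-scale : ∀ {E E′} → E ≅ E′ →
    ∃ λ u → u ≢ 0# × u * u * u * u * c₄ E′ ≡ c₄ E × u * u * u * u * u * u * c₆ E′ ≡ c₆ E
  ≅⇒c₄c₆-scale {E} {E′} E≅E′ with ≅⇒scale≡shift E≅E′
  ... | u , r , s , t , u≢0 , scaled≡shifted = u , u≢0 ,
    trans (sym (c₄-scale u E′)) (trans (cong c₄ scaled≡shifted) (c₄-shift r s t E)) ,
    trans (sym (c₆-scale u E′)) (trans (cong c₆ scaled≡shifted) (c₆-shift r s t E))

  scale-1 : ∀ E → scale 1# E ≡ E
  scale-1 (mkW a1 a2 a3 a4 a6) = mkW-cong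
    (*-identityˡ a1)
    (solve 1 (λ a → κ 1 :* κ 1 :* a := a) refl a2)
    (solve 1 (λ a → κ 1 :* κ 1 :* κ 1 :* a := a) refl a3)
    (solve 1 (λ a → κ 1 :* κ 1 :* κ 1 :* κ 1 :* a := a) refl a4)
    (solve 1 (λ a → κ 1 :* κ 1 :* κ 1 :* κ 1 :* κ 1 :* κ 1 :* a := a) refl a6)

  shift-0 : ∀ E → shift 0# 0# 0# E ≡ E
  shift-0 (mkW a1 a2 a3 a4 a6) = mkW-cong
    (solve 1 (λ a1 → a1 :+ κ 2 :* κ 0 := a1) refl a1)
    (solve 2 (λ a1 a2 → a2 :- κ 0 :* a1 :+ κ 3 :* κ 0 :- κ 0 :* κ 0 := a2) refl a1 a2)
    (solve 2 (λ a1 a3 → a3 :+ κ 0 :* a1 :+ κ 2 :* κ 0 := a3) refl a1 a3)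
    (solve 4 (λ a1 a2 a3 a4 → a4 :- κ 0 :* a3 :+ κ 2 :* κ 0 :* a2 :- (κ 0 :+ κ 0 :* κ 0) :* a1
                                :+ κ 3 :* κ 0 :* κ 0 :- κ 2 :* κ 0 :* κ 0 := a4) refl a1 a2 a3 a4)
    (solve 5 (λ a1 a2 a3 a4 a6 → a6 :+ κ 0 :* a4 :+ κ 0 :* κ 0 :* a2 :+ κ 0 :* κ 0 :* κ 0 :- κ 0 :* a3
                                   :- κ 0 :* κ 0 :- κ 0 :* κ 0 :* a1 := a6) refl a1 a2 a3 a4 a6)

  ≅-refl : ∀ {E} → E ≅ E
  ≅-refl {E} = scale≡shift⇒≅ (λ 1≡0 → 0≢1 (sym 1≡0)) (trans (scale-1 E) (sym (shift-0 E)))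

  c₄≡0⇒c₆≢0 : ∀ {E} → fromℕ 1728 ≢ 0# → Δ E ≢ 0# → c₄ E ≡ 0# → c₆ E ≢ 0#
  c₄≡0⇒c₆≢0 {E} 1728≢0 Δ≢0 c₄≡0 c₆≡0 = *-≢0 1728≢0 Δ≢0 (begin
    fromℕ 1728 * Δ E                     ≡⟨ sym (c₄³-c₆²≡1728Δ E) ⟩
    c₄ E * c₄ E * c₄ E - c₆ E * c₆ E     ≡⟨ cong₂ (λ x y → x * x * x - y * y) c₄≡0 c₆≡0 ⟩
    0# * 0# * 0# - 0# * 0#               ≡⟨ solve 0 (κ 0 :* κ 0 :* κ 0 :- κ 0 :* κ 0 := κ 0) refl ⟩
    0#                                   ∎)
    where open ≡-Reasoning

-- Counting in a finite field

module FieldCounting (F : FiniteField) where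
  open FF F
  open FieldArithmetic F
  open OrbitCounting _≟_
  open DecMembership _≟_ using (_∈?_)
  open RawSemiringDefinitions (Semiring.rawSemiring (CommutativeRing.semiring commutativeRing)) using () renaming (_^_ to _^ᶠ_)

  elements : List Carrier
  elements = tabulate (Inverse.from enum)

  ∈-elements : ∀ x → x ∈ elements
  ∈-elements x = subst (_∈ elements) (Inverse.strictlyInverseʳ enum x) (∈-tabulate⁺ (Inverse.to enum x))

  length-elements : length elements ≡ card
  length-elements = length-tabulate (Inverse.from enum)

  elements-unique : Unique elements
  elements-unique = Unique.tabulate⁺ (λ {i} {j} fromᵢ≡fromⱼ →
    trans (sym (Inverse.strictlyInverseˡ enum i)) (trans (cong (Inverse.to enum) fromᵢ≡fromⱼ) (Inverse.strictlyInverseˡ enum j)))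

  elements∖-unique : ∀ S → Unique (elements ∖ S)
  elements∖-unique S = Unique.filter⁺ (λ y → ¬? (y ∈? S)) elements-unique

  ∈-elements∖ : ∀ {S x} → x ∉ S → x ∈ elements ∖ S
  ∈-elements∖ {S} {x} x∉S = ∈-filter⁺ (λ y → ¬? (y ∈? S)) (∈-elements x) x∉S

  All-∉-elements∖ : ∀ S → All (_∉ S) (elements ∖ S)
  All-∉-elements∖ S = All.tabulate (λ x∈ → proj₂ (∈-filter⁻ (λ y → ¬? (y ∈? S)) {xs = elements} x∈))

  ∈-elements∖-map : ∀ {S x} {f : Carrier → Carrier} →
    (∀ {y} → y ∉ S → f y ∉ S) → x ∈ elements ∖ S → f x ∈ elements ∖ S
  ∈-elements∖-map {S} f-∉S x∈ = ∈-elements∖ (f-∉S (All.lookup (All-∉-elements∖ S) x∈))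

  card%n≡length%n : ∀ {S n} .{{_ : NonZero n}} → Unique S → n ∣ length (elements ∖ S) → card % n ≡ length S % n
  card%n≡length%n {S} {n} S-unique n∣ = begin
    card % n                                 ≡⟨ cong (_% n) (sym length-elements) ⟩
    length elements % n                      ≡⟨ cong (_% n) (length-∖ S-unique elements-unique (λ {x} _ → ∈-elements x)) ⟩
    (length S ℕ.+ length (elements ∖ S)) % n ≡⟨ %-remove-+ʳ (length S) n∣ ⟩
    length S % n                             ∎
    where open ≡-Reasoning

  IsSquare? : Decidable IsSquare
  IsSquare? x = map′ Any.satisfied (λ (y , y²≡x) → lose (∈-elements y) y²≡x) (any? (λ y → y * y ≟ x) elements)

  additive-order∣card : ∀ n .{{_ : NonZero n}} →
    fromℕ n ≡ 0# → (∀ {i} → 0 < i → i < n → fromℕ i ≢ 0#) → n ∣ card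
  additive-order∣card n n≡0 i≢0 = subst (n ∣_) length-elements
    (σ-closed⇒∣length {D = U} (1# +_) n (λ _ → tt) period aperiodic
      elements-unique (All.universal (λ _ → tt) elements) (λ {x} _ → ∈-elements (1# + x)))
    where
      fold-1+ : ∀ i x → fold x (1# +_) i ≡ fromℕ i + x
      fold-1+ zero    x = sym (+-identityˡ x)
      fold-1+ (suc i) x = trans (cong (1# +_) (fold-1+ i x)) (sym (+-assoc 1# (fromℕ i) x))

      period : ∀ {x} → U x → fold x (1# +_) n ≡ x
      period {x} _ = trans (fold-1+ n x) (trans (cong (_+ x) n≡0) (+-identityˡ x))

      aperiodic : ∀ {x i} → U x → 0 < i → i < n → fold x (1# +_) i ≢ x
      aperiodic {x} {i} _ 0<i i<n iᵗʰ≡x = i≢0 0<i i<n (+-identityˡ-unique (fromℕ i) x (trans (sym (fold-1+ i x)) iᵗʰ≡x))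

  fromℕ2≡0⇒2∣card : fromℕ 2 ≡ 0# → 2 ∣ card
  fromℕ2≡0⇒2∣card 2≡0 = additive-order∣card 2 2≡0 λ
    { {1} _ _ → fromℕ-1≢0
    ; {suc (suc _)} _ (s≤s (s≤s ())) }

  fromℕ3≡0⇒3∣card : fromℕ 3 ≡ 0# → 3 ∣ card
  fromℕ3≡0⇒3∣card 3≡0 = additive-order∣card 3 3≡0 λ
    { {1} _ _ → fromℕ-1≢0
    ; {2} _ _ 2≡0 → fromℕ-1≢0 (trans (cong (1# +_) (sym 2≡0)) 3≡0)
    ; {suc (suc (suc _))} _ (s≤s (s≤s (s≤s ()))) }

  multiplicative-order⇒card%n≡1 : ∀ {g} n .{{_ : NonZero n}} →
    g ^ᶠ n ≡ 1# → (∀ {i} → 0 < i → i < n → g ^ᶠ i ≢ 1#) → card % n ≡ 1 % n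
  multiplicative-order⇒card%n≡1 {g} n gⁿ≡1 gⁱ≢1 = card%n≡length%n ([] ∷ [])
    (σ-closed⇒∣length {D = _∉ Z} (g *_) n D-g* period aperiodic
      (elements∖-unique Z) (All-∉-elements∖ Z) (∈-elements∖-map D-g*))
    where
      Z : List Carrier
      Z = 0# ∷ []

      fold-g* : ∀ i x → fold x (g *_) i ≡ g ^ᶠ i * x
      fold-g* zero    x = sym (*-identityˡ x)
      fold-g* (suc i) x = trans (cong (g *_) (fold-g* i x)) (sym (*-assoc g (g ^ᶠ i) x))

      g≢0 : g ≢ 0#
      g≢0 refl = 0≢1 (begin
        0#                      ≡⟨ sym (zeroˡ _) ⟩
        0# * 0# ^ᶠ ℕ.pred n     ≡⟨ cong (0# ^ᶠ_) (ℕ.suc-pred n) ⟩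
        0# ^ᶠ n                 ≡⟨ gⁿ≡1 ⟩
        1#                      ∎)
        where open ≡-Reasoning

      D-g* : ∀ {x} → x ∉ Z → g * x ∉ Z
      D-g* x∉Z (here gx≡0) = *-≢0 g≢0 (λ x≡0 → x∉Z (here x≡0)) gx≡0

      period : ∀ {x} → x ∉ Z → fold x (g *_) n ≡ x
      period {x} _ = trans (fold-g* n x) (trans (cong (_* x) gⁿ≡1) (*-identityˡ x))

      aperiodic : ∀ {x i} → x ∉ Z → 0 < i → i < n → fold x (g *_) i ≢ x
      aperiodic {x} {i} x∉Z 0<i i<n iᵗʰ≡x =
        gⁱ≢1 0<i i<n (*-cancelʳ-≢0 (λ x≡0 → x∉Z (here x≡0))
          (trans (sym (fold-g* i x)) (trans iᵗʰ≡x (sym (*-identityˡ x)))))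

  primitive-cube-root⇒card%3≡1 : ∀ {ω} → ω ≢ 1# → ω * ω * ω ≡ 1# → card % 3 ≡ 1
  primitive-cube-root⇒card%3≡1 {ω} ω≢1 ω³≡1 = multiplicative-order⇒card%n≡1 3 ω^3≡1 ω^i≢1
    where
      ω^3≡1 : ω ^ᶠ 3 ≡ 1#
      ω^3≡1 = trans (solve 1 (λ ω → ω :* (ω :* (ω :* κ 1)) := ω :* ω :* ω) refl ω) ω³≡1

      ω^i≢1 : ∀ {i} → 0 < i → i < 3 → ω ^ᶠ i ≢ 1#
      ω^i≢1 {1} _ _ ω≡1 = ω≢1 (trans (sym (*-identityʳ ω)) ω≡1)
      ω^i≢1 {2} _ _ ω²≡1 = ω≢1 (begin
        ω            ≡⟨ sym (*-identityʳ ω) ⟩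
        ω * 1#       ≡⟨ cong (ω *_) (sym ω²≡1) ⟩
        ω * ω ^ᶠ 2   ≡⟨ solve 1 (λ ω → ω :* (ω :* (ω :* κ 1)) := ω :* ω :* ω) refl ω ⟩
        ω * ω * ω    ≡⟨ ω³≡1 ⟩
        1#           ∎)
        where open ≡-Reasoning
      ω^i≢1 {suc (suc (suc _))} _ (s≤s (s≤s (s≤s ())))

  module _ (2≢0 : fromℕ 2 ≢ 0#) where

    √-1⇒card%4≡1 : IsSquare (- 1#) → card % 4 ≡ 1
    √-1⇒card%4≡1 (i , i²≡-1) = multiplicative-order⇒card%n≡1 4 i^4≡1 i^j≢1
      where
        open ≡-Reasoning
        i²≢1 : i * i ≢ 1#
        i²≢1 i²≡1 = 1≢-1 2≢0 (trans (sym i²≡1) i²≡-1)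

        i^4≡1 : i ^ᶠ 4 ≡ 1#
        i^4≡1 = begin
          i ^ᶠ 4                ≡⟨ solve 1 (λ i → i :* (i :* (i :* (i :* κ 1))) := (i :* i) :* (i :* i)) refl i ⟩
          (i * i) * (i * i)     ≡⟨ cong₂ _*_ i²≡-1 i²≡-1 ⟩
          - 1# * - 1#           ≡⟨ solve 0 (:- κ 1 :* :- κ 1 := κ 1) refl ⟩
          1#                    ∎

        i≢1 : i ≢ 1#
        i≢1 i≡1 = i²≢1 (trans (cong₂ _*_ i≡1 i≡1) (*-identityˡ 1#))

        i^j≢1 : ∀ {j} → 0 < j → j < 4 → i ^ᶠ j ≢ 1#

        i^j≢1 {1} _ _ i¹≡1 = i≢1 (trans (sym (*-identityʳ i)) i¹≡1)
        i^j≢1 {2} _ _ i²≡1 = i²≢1 (trans (cong (i *_) (sym (*-identityʳ i))) i²≡1)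
        i^j≢1 {3} _ _ i³≡1 = i≢1 (begin
          i             ≡⟨ sym (*-identityʳ i) ⟩
          i * 1#        ≡⟨ cong (i *_) (sym i³≡1) ⟩
          i * i ^ᶠ 3    ≡⟨ i^4≡1 ⟩
          1#            ∎)
        i^j≢1 {suc (suc (suc (suc _)))} _ (s≤s (s≤s (s≤s (s≤s ()))))

    private
      0±1 : List Carrier
      0±1 = 0# ∷ 1# ∷ - 1# ∷ []

      0±1-unique : Unique 0±1
      0±1-unique =
          (0≢1 ∷ (λ 0≡-1 → -‿≢0 (λ 1≡0 → 0≢1 (sym 1≡0)) (sym 0≡-1)) ∷ [])
        ∷ (1≢-1 2≢0 ∷ [])
        ∷ [] ∷ []

      ∉0±1 : ∀ {x} → x ≢ 0# → x ≢ 1# → x ≢ - 1# → x ∉ 0±1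
      ∉0±1 x≢0 _   _    (here x≡0)                  = x≢0 x≡0
      ∉0±1 _   x≢1 _    (there (here x≡1))          = x≢1 x≡1
      ∉0±1 _   _   x≢-1 (there (there (here x≡-1))) = x≢-1 x≡-1

      ∉0±1⇒≢0 : ∀ {x} → x ∉ 0±1 → x ≢ 0#
      ∉0±1⇒≢0 x∉ x≡0 = x∉ (here x≡0)

      -‿∉0±1 : ∀ {x} → x ∉ 0±1 → - x ∉ 0±1
      -‿∉0±1 {x} x∉ = ∉0±1
        (λ -x≡0 → x∉ (here (trans (-x≡y⇒x≡-y -x≡0) -0#≈0#)))
        (λ -x≡1 → x∉ (there (there (here (-x≡y⇒x≡-y -x≡1)))))
        (λ -x≡-1 → x∉ (there (here (trans (-x≡y⇒x≡-y -x≡-1) (-‿involutive 1#)))))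
        where
          -x≡y⇒x≡-y : ∀ {y} → - x ≡ y → x ≡ - y
          -x≡y⇒x≡-y -x≡y = trans (sym (-‿involutive x)) (cong -_ -x≡y)

      ⁻¹-∉0±1 : ∀ {x} → x ∉ 0±1 → x ⁻¹ ∉ 0±1
      ⁻¹-∉0±1 {x} x∉ = ∉0±1
        (⁻¹-≢0 (∉0±1⇒≢0 x∉))
        (λ x⁻¹≡1 → x∉ (there (here (trans (x⁻¹≡y⇒x≡y⁻¹ x⁻¹≡1) (⁻¹-unique (*-identityˡ 1#))))))
        (λ x⁻¹≡-1 → x∉ (there (there (here (trans (x⁻¹≡y⇒x≡y⁻¹ x⁻¹≡-1) (⁻¹-unique -1*-1≡1))))))
        where
          -1*-1≡1 : - 1# * - 1# ≡ 1#
          -1*-1≡1 = solve 0 (:- κ 1 :* :- κ 1 := κ 1) refl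

          x⁻¹≡y⇒x≡y⁻¹ : ∀ {y} → x ⁻¹ ≡ y → x ≡ y ⁻¹
          x⁻¹≡y⇒x≡y⁻¹ x⁻¹≡y = trans (sym (⁻¹-involutive (∉0±1⇒≢0 x∉))) (cong _⁻¹ x⁻¹≡y)

      ∉0±1⇒x≢x⁻¹ : ∀ {x} → x ∉ 0±1 → x ≢ x ⁻¹
      ∉0±1⇒x≢x⁻¹ {x} x∉ x≡x⁻¹ =
        [ (λ x≡1 → x∉ (there (here x≡1))) , (λ x≡-1 → x∉ (there (there (here x≡-1)))) ]′
        (x²≡1⇒x≡±1 (trans (cong (x *_) x≡x⁻¹) (⁻¹-inverse x (∉0±1⇒≢0 x∉))))

    ¬√-1⇒card%4≡3 : ¬ IsSquare (- 1#) → card % 4 ≡ 3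
    ¬√-1⇒card%4≡3 ¬√-1 = card%n≡length%n 0±1-unique
      (ν-ι-closed⇒4∣length {D = _∉ 0±1} -_ _⁻¹ -‿∉0±1 ⁻¹-∉0±1
        (λ {x} _ → -‿involutive x) (λ x∉ → ⁻¹-involutive (∉0±1⇒≢0 x∉))
        (λ x∉ → -‿⁻¹-comm (∉0±1⇒≢0 x∉))
        (λ x∉ → x≢-x 2≢0 (∉0±1⇒≢0 x∉)) ∉0±1⇒x≢x⁻¹ x≢-x⁻¹
        (elements∖-unique 0±1) (All-∉-elements∖ 0±1) (∈-elements∖-map -‿∉0±1) (∈-elements∖-map ⁻¹-∉0±1))
      where
        x≢-x⁻¹ : ∀ {x} → x ∉ 0±1 → x ≢ - (x ⁻¹)
        x≢-x⁻¹ {x} x∉ x≡-x⁻¹ = ¬√-1 (x , (begin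
          x * x          ≡⟨ cong (x *_) x≡-x⁻¹ ⟩
          x * - (x ⁻¹)   ≡⟨ sym (-‿distribʳ-* x (x ⁻¹)) ⟩
          - (x * x ⁻¹)   ≡⟨ cong -_ (⁻¹-inverse x (∉0±1⇒≢0 x∉)) ⟩
          - 1#           ∎))
          where open ≡-Reasoning

-- Legendre curves with j = 0

module LegendreCurves (F : FiniteField) where
  open FF F
  open FieldArithmetic F
  open WeierstrassInvariants F

  Φ₆ : Carrier → Carrier
  Φ₆ l = l * l - l + 1#

  Φ₆ˢ : ∀ {n} → Polynomial n → Polynomial n
  Φ₆ˢ l = l :* l :- l :+ κ 1

  c₄-Leg : ∀ l → c₄ (Leg l) ≡ fromℕ 16 * Φ₆ l
  c₄-Leg = solve 1 (λ l → Syntax.c₄ (κ 0) (:- (κ 1 :+ l)) (κ 0) l (κ 0) := κ 16 :* Φ₆ˢ l) refl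

  c₆-Leg-flip : ∀ l → c₆ (Leg (1# - l)) ≡ - c₆ (Leg l)
  c₆-Leg-flip = solve 1 (λ l → Syntax.c₆ (κ 0) (:- (κ 1 :+ (κ 1 :- l))) (κ 0) (κ 1 :- l) (κ 0)
                              := :- Syntax.c₆ (κ 0) (:- (κ 1 :+ l)) (κ 0) l (κ 0)) refl

  Δ-Leg : ∀ l → Δ (Leg l) ≡ fromℕ 16 * (l * (l - 1#) * (l * (l - 1#)))
  Δ-Leg = solve 1 (λ l →
    Syntax.Δ (κ 0) (:- (κ 1 :+ l)) (κ 0) l (κ 0) := κ 16 :* (l :* (l :- κ 1) :* (l :* (l :- κ 1)))) refl

  Φ₆-roots : ∀ {l β} → Φ₆ l ≡ 0# → Φ₆ β ≡ 0# → β ≡ l ⊎ β ≡ 1# - l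
  Φ₆-roots {l} {β} Φ₆l≡0 Φ₆β≡0 =
    Sum.map (x∙y⁻¹≈ε⇒x≈y β l) (x∙y⁻¹≈ε⇒x≈y β (1# - l)) (x*y≡0⇒x≡0⊎y≡0 (begin
    (β - l) * (β - (1# - l)) ≡⟨ solve 2 (λ β l → (β :- l) :* (β :- (κ 1 :- l)) := Φ₆ˢ β :- Φ₆ˢ l) refl β l ⟩
    Φ₆ β - Φ₆ l              ≡⟨ cong₂ _-_ Φ₆β≡0 Φ₆l≡0 ⟩
    0# - 0#                  ≡⟨ -‿inverseʳ 0# ⟩
    0#                       ∎))
    where open ≡-Reasoning

  Φ₆≡0⇒l³≡-1 : ∀ {l} → Φ₆ l ≡ 0# → l * l * l ≡ - 1#
  Φ₆≡0⇒l³≡-1 {l} = ≡-modulo (l + 1#) (solve 1 (λ l → l :* l :* l := :- κ 1 :+ (l :+ κ 1) :* Φ₆ˢ l) refl l)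

  Φ₆≡0⇒[-l]³≡1 : ∀ {l} → Φ₆ l ≡ 0# → - l * - l * - l ≡ 1#
  Φ₆≡0⇒[-l]³≡1 {l} =
    ≡-modulo (- (l + 1#)) (solve 1 (λ l → :- l :* :- l :* :- l := κ 1 :+ :- (l :+ κ 1) :* Φ₆ˢ l) refl l)

  √-1⇒IsSquare : ∀ {l} → Φ₆ l ≡ 0# → IsSquare (- 1#) → IsSquare l
  √-1⇒IsSquare {l} Φ₆l≡0 (i , i²≡-1) = i * (l * l) , (begin
    (i * (l * l)) * (i * (l * l)) ≡⟨ solve 2 (λ i l → (i :* (l :* l)) :* (i :* (l :* l))
                                                  := (i :* i) :* (l :* l :* l) :* l) refl i l ⟩
    (i * i) * (l * l * l) * l     ≡⟨ cong₂ (λ x y → x * y * l) i²≡-1 (Φ₆≡0⇒l³≡-1 Φ₆l≡0) ⟩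
    - 1# * - 1# * l               ≡⟨ solve 1 (λ l → :- κ 1 :* :- κ 1 :* l := l) refl l ⟩
    l                             ∎)
    where open ≡-Reasoning

  IsSquare⇒√-1 : ∀ {l} → Φ₆ l ≡ 0# → IsSquare l → IsSquare (- 1#)
  IsSquare⇒√-1 {l} Φ₆l≡0 (y , y²≡l) = y * l , (begin
    (y * l) * (y * l) ≡⟨ solve 2 (λ y l → (y :* l) :* (y :* l) := (y :* y) :* l :* l) refl y l ⟩
    (y * y) * l * l   ≡⟨ cong (λ x → x * l * l) y²≡l ⟩
    l * l * l         ≡⟨ Φ₆≡0⇒l³≡-1 Φ₆l≡0 ⟩
    - 1#              ∎)
    where open ≡-Reasoning

  √-1⇒Leg[1-l]≅Leg[l] : ∀ {l} → l ≢ 1# → Φ₆ l ≡ 0# → IsSquare (- 1#) → Leg (1# - l) ≅ Leg l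
  √-1⇒Leg[1-l]≅Leg[l] {l} l≢1 Φ₆l≡0 (i , i²≡-1) = scale≡shift⇒≅ u≢0 (begin
    scale u (Leg l)        ≡⟨ mkW-cong (zeroʳ u) a2 (zeroʳ _) a4 (zeroʳ _) ⟩
    Leg (1# - l)           ≡⟨ sym (shift-0 (Leg (1# - l))) ⟩
    shift 0# 0# 0# (Leg (1# - l)) ∎)
    where
      open ≡-Reasoning
      u : Carrier
      u = i * l

      u²≡1-l : u * u ≡ 1# - l
      u²≡1-l = begin
        (i * l) * (i * l) ≡⟨ solve 2 (λ i l → (i :* l) :* (i :* l) := (i :* i) :* (l :* l)) refl i l ⟩
        (i * i) * (l * l) ≡⟨ cong (_* (l * l)) i²≡-1 ⟩
        - 1# * (l * l)    ≡⟨ ≡-modulo (- 1#)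
                               (solve 1 (λ l → :- κ 1 :* (l :* l) := (κ 1 :- l) :+ :- κ 1 :* Φ₆ˢ l) refl l) Φ₆l≡0 ⟩
        1# - l            ∎

      u≢0 : u ≢ 0#
      u≢0 u≡0 = l≢1 (sym (x∙y⁻¹≈ε⇒x≈y 1# l (trans (sym u²≡1-l) (trans (cong (λ x → x * x) u≡0) (zeroˡ 0#)))))

      a2 : u * u * (- (1# + l)) ≡ - (1# + (1# - l))
      a2 = begin
        u * u * (- (1# + l))     ≡⟨ cong (_* (- (1# + l))) u²≡1-l ⟩
        (1# - l) * (- (1# + l))  ≡⟨ ≡-modulo 1# (solve 1 (λ l → (κ 1 :- l) :* (:- (κ 1 :+ l))
                                      := :- (κ 1 :+ (κ 1 :- l)) :+ κ 1 :* Φ₆ˢ l) refl l) Φ₆l≡0 ⟩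
        - (1# + (1# - l))        ∎

      a4 : u * u * u * u * l ≡ 1# - l
      a4 = begin
        u * u * u * u * l          ≡⟨ solve 2 (λ u l → u :* u :* u :* u :* l := (u :* u) :* (u :* u) :* l) refl u l ⟩
        (u * u) * (u * u) * l      ≡⟨ cong (λ x → x * x * l) u²≡1-l ⟩
        (1# - l) * (1# - l) * l    ≡⟨ ≡-modulo (l - 1#) (solve 1 (λ l → (κ 1 :- l) :* (κ 1 :- l) :* l
                                        := (κ 1 :- l) :+ (l :- κ 1) :* Φ₆ˢ l) refl l) Φ₆l≡0 ⟩
        1# - l                     ∎

  Φ₆≡0⇒-l≢1 : ∀ {l} → fromℕ 3 ≢ 0# → Φ₆ l ≡ 0# → - l ≢ 1#
  Φ₆≡0⇒-l≢1 {l} 3≢0 Φ₆l≡0 -l≡1 = 3≢0 (begin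
    fromℕ 3                           ≡⟨ solve 1 (λ l → κ 3 := Φ₆ˢ l :+ (l :- κ 2) :* (:- l :- κ 1)) refl l ⟩
    Φ₆ l + (l - fromℕ 2) * (- l - 1#) ≡⟨ cong₂ (λ x y → x + (l - fromℕ 2) * y) Φ₆l≡0 (x≈y⇒x∙y⁻¹≈ε -l≡1) ⟩
    0# + (l - fromℕ 2) * 0#           ≡⟨ solve 1 (λ l → κ 0 :+ (l :- κ 2) :* κ 0 := κ 0) refl l ⟩
    0#                                ∎)
    where open ≡-Reasoning

  l≢1-l : ∀ {l} → fromℕ 3 ≢ 0# → Φ₆ l ≡ 0# → l ≢ 1# - l
  l≢1-l {l} 3≢0 Φ₆l≡0 l≡1-l = 3≢0 (begin
    fromℕ 3                  ≡⟨ solve 1 (λ l → κ 3 := κ 4 :* Φ₆ˢ l :- (l :- (κ 1 :- l)) :* (l :- (κ 1 :- l))) refl l ⟩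
    fromℕ 4 * Φ₆ l - d * d   ≡⟨ cong₂ (λ x y → fromℕ 4 * x - y * y) Φ₆l≡0 (x≈y⇒x∙y⁻¹≈ε l≡1-l) ⟩
    fromℕ 4 * 0# - 0# * 0#   ≡⟨ solve 0 (κ 4 :* κ 0 :- κ 0 :* κ 0 := κ 0) refl ⟩
    0#                       ∎)
    where
      open ≡-Reasoning
      d : Carrier
      d = l - (1# - l)

  module _ (2≢0 : fromℕ 2 ≢ 0#) where

    16≢0 : fromℕ 16 ≢ 0#
    16≢0 = fromℕ-^-≢0 2 4 2≢0

    jLeg≡0⇒Φ₆≡0 : ∀ {l} → l ≢ 0# → l ≢ 1# → jLeg l ≡ 0# → Φ₆ l ≡ 0#
    jLeg≡0⇒Φ₆≡0 {l} l≢0 l≢1 jLeg≡0 with Φ₆ l ≟ 0#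
    ... | yes Φ₆l≡0 = Φ₆l≡0
    ... | no  Φ₆l≢0 = contradiction jLeg≡0
      (*-≢0 (*-≢0 (fromℕ-^-≢0 2 8 2≢0) (*-≢0 (*-≢0 Φ₆l≢0 Φ₆l≢0) Φ₆l≢0))
            (⁻¹-≢0 (*-≢0 (*-≢0 l≢0 l≢0) (*-≢0 l-1≢0 l-1≢0))))
      where
        l-1≢0 : l - 1# ≢ 0#
        l-1≢0 l-1≡0 = l≢1 (x∙y⁻¹≈ε⇒x≈y l 1# l-1≡0)

    Leg≅Leg⇒Φ₆≡0 : ∀ {l β} → Φ₆ l ≡ 0# → Leg β ≅ Leg l → Φ₆ β ≡ 0#
    Leg≅Leg⇒Φ₆≡0 {l} {β} Φ₆l≡0 Legβ≅Legl =
      let (u , _ , u⁴c₄≡c₄ , _) = ≅⇒c₄c₆-scale Legβ≅Legl in x*y≡0⇒y≡0 16≢0 (begin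
      fromℕ 16 * Φ₆ β                       ≡⟨ sym (c₄-Leg β) ⟩
      c₄ (Leg β)                             ≡⟨ sym u⁴c₄≡c₄ ⟩
      u * u * u * u * c₄ (Leg l)             ≡⟨ cong (u * u * u * u *_) (c₄-Leg l) ⟩
      u * u * u * u * (fromℕ 16 * Φ₆ l)      ≡⟨ cong (λ x → u * u * u * u * (fromℕ 16 * x)) Φ₆l≡0 ⟩
      u * u * u * u * (fromℕ 16 * 0#)        ≡⟨ solve 1 (λ u → u :* u :* u :* u :* (κ 16 :* κ 0) := κ 0) refl u ⟩
      0#                                     ∎)
      where open ≡-Reasoning

    module _ (3≢0 : fromℕ 3 ≢ 0#) where

      Φ₆≡0⇒c₆-Leg≢0 : ∀ {l} → l ≢ 0# → l ≢ 1# → Φ₆ l ≡ 0# → c₆ (Leg l) ≢ 0#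
      Φ₆≡0⇒c₆-Leg≢0 {l} l≢0 l≢1 Φ₆l≡0 = c₄≡0⇒c₆≢0
        (fromℕ-*-≢0 (2 ℕ.^ 6) (3 ℕ.^ 3) (fromℕ-^-≢0 2 6 2≢0) (fromℕ-^-≢0 3 3 3≢0))
        (subst (_≢ 0#) (sym (Δ-Leg l)) (*-≢0 16≢0 (*-≢0 l[l-1]≢0 l[l-1]≢0)))
        (trans (c₄-Leg l) (trans (cong (fromℕ 16 *_) Φ₆l≡0) (zeroʳ _)))
        where
          l[l-1]≢0 : l * (l - 1#) ≢ 0#
          l[l-1]≢0 = *-≢0 l≢0 (λ l-1≡0 → l≢1 (x∙y⁻¹≈ε⇒x≈y l 1# l-1≡0))

      Leg[1-l]≅Leg[l]⇒√-1 : ∀ {l} → l ≢ 0# → l ≢ 1# → Φ₆ l ≡ 0# → Leg (1# - l) ≅ Leg l → IsSquare (- 1#)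
      Leg[1-l]≅Leg[l]⇒√-1 {l} l≢0 l≢1 Φ₆l≡0 Leg[1-l]≅Leg[l] =
        let (u , _ , _ , u⁶c₆≡c₆) = ≅⇒c₄c₆-scale Leg[1-l]≅Leg[l] in u * u * u , u³²≡-1 u u⁶c₆≡c₆
        where
          open ≡-Reasoning
          c : Carrier
          c = c₆ (Leg l)

          u³²≡-1 : ∀ u → u * u * u * u * u * u * c ≡ c₆ (Leg (1# - l)) → (u * u * u) * (u * u * u) ≡ - 1#
          u³²≡-1 u u⁶c≡c₆ = ≡-modulo 1#
            (solve 1 (λ u → (u :* u :* u) :* (u :* u :* u) := :- κ 1 :+ κ 1 :* (u :* u :* u :* u :* u :* u :+ κ 1)) refl u)
            (x*y≡0⇒y≡0 (Φ₆≡0⇒c₆-Leg≢0 l≢0 l≢1 Φ₆l≡0) (begin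
              c * (u⁶ + 1#)    ≡⟨ solve 2 (λ c u⁶ → c :* (u⁶ :+ κ 1) := u⁶ :* c :+ c) refl c u⁶ ⟩
              u⁶ * c + c       ≡⟨ cong (_+ c) (trans u⁶c≡c₆ (c₆-Leg-flip l)) ⟩
              - c + c          ≡⟨ -‿inverseˡ c ⟩
              0#               ∎))
            where
              u⁶ : Carrier
              u⁶ = u * u * u * u * u * u

      L-of-Φ₆-root : ∀ {l} → l ≢ 0# → l ≢ 1# → Φ₆ l ≡ 0# →
                     ∀ β → L l β ⇔ (β ≡ l ⊎ (β ≡ 1# - l × IsSquare (- 1#)))
      L-of-Φ₆-root {l} l≢0 l≢1 Φ₆l≡0 β = mk⇔ to from
        where
          to : L l β → β ≡ l ⊎ (β ≡ 1# - l × IsSquare (- 1#))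
          to (_ , _ , Legβ≅Legl) = Sum.map₂
            (λ β≡1-l → β≡1-l ,
               Leg[1-l]≅Leg[l]⇒√-1 l≢0 l≢1 Φ₆l≡0 (subst (λ b → Leg b ≅ Leg l) β≡1-l Legβ≅Legl))
            (Φ₆-roots Φ₆l≡0 (Leg≅Leg⇒Φ₆≡0 Φ₆l≡0 Legβ≅Legl))

          from : β ≡ l ⊎ (β ≡ 1# - l × IsSquare (- 1#)) → L l β
          from (inj₁ refl)          = l≢0 , l≢1 , ≅-refl
          from (inj₂ (refl , √-1)) = 1-l≢0 , 1-l≢1 , √-1⇒Leg[1-l]≅Leg[l] l≢1 Φ₆l≡0 √-1
            where
              1-l≢0 : 1# - l ≢ 0#
              1-l≢0 1-l≡0 = l≢1 (sym (x∙y⁻¹≈ε⇒x≈y 1# l 1-l≡0))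
              1-l≢1 : 1# - l ≢ 1#
              1-l≢1 1-l≡1 = l≢0 (trans (solve 1 (λ l → l := κ 1 :- (κ 1 :- l)) refl l)
                                       (trans (cong (λ x → 1# - x) 1-l≡1) (-‿inverseʳ 1#)))

      module _ {l} (l≢0 : l ≢ 0#) (l≢1 : l ≢ 1#) (Φ₆l≡0 : Φ₆ l ≡ 0#) where
        open Equivalence using (to; from)
        private
          characterisation : ∀ β → L l β ⇔ (β ≡ l ⊎ (β ≡ 1# - l × IsSquare (- 1#)))
          characterisation = L-of-Φ₆-root l≢0 l≢1 Φ₆l≡0

        √-1⇒|L|≡2 : IsSquare (- 1#) → HasSize (L l) 2
        √-1⇒|L|≡2 √-1 = l ∷ 1# - l ∷ [] , (l≢1-l 3≢0 Φ₆l≡0 ∷ []) ∷ [] ∷ [] , refl , λ β → ⇒∈ β , ∈⇒ β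
          where
            ⇒∈ : ∀ β → L l β → β ∈ l ∷ 1# - l ∷ []
            ⇒∈ β Llβ = [ here , (λ (β≡1-l , _) → there (here β≡1-l)) ]′ (to (characterisation β) Llβ)

            ∈⇒ : ∀ β → β ∈ l ∷ 1# - l ∷ [] → L l β
            ∈⇒ β (here β≡l)           = from (characterisation β) (inj₁ β≡l)
            ∈⇒ β (there (here β≡1-l)) = from (characterisation β) (inj₂ (β≡1-l , √-1))

        ¬√-1⇒|L|≡1 : ¬ IsSquare (- 1#) → HasSize (L l) 1
        ¬√-1⇒|L|≡1 ¬√-1 = l ∷ [] , [] ∷ [] , refl , λ β → ⇒∈ β , ∈⇒ β
          where
            ⇒∈ : ∀ β → L l β → β ∈ l ∷ []
            ⇒∈ β Llβ = [ here , (λ (_ , √-1) → contradiction √-1 ¬√-1) ]′ (to (characterisation β) Llβ)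

            ∈⇒ : ∀ β → β ∈ l ∷ [] → L l β
            ∈⇒ β (here β≡l) = from (characterisation β) (inj₁ β≡l)

prime∣prime^k⇒≡ : ∀ {q p} k → Prime q → Prime p → q ∣ p ^ k → q ≡ p
prime∣prime^k⇒≡ zero q-prime _ q∣1 = contradiction (subst Prime (∣1⇒≡1 q∣1) q-prime) ¬prime[1]
prime∣prime^k⇒≡ {q} {p} (suc k) q-prime p-prime q∣p^[1+k] with euclidsLemma p (p ^ k) q-prime q∣p^[1+k]
... | inj₁ q∣p   = [ (λ q≡1 → contradiction (subst Prime q≡1 q-prime) ¬prime[1]) , id ]′ (prime⇒irreducible p-prime q∣p)
... | inj₂ q∣p^k = prime∣prime^k⇒≡ k q-prime p-prime q∣p^k

prime<p⇒∤p^k : ∀ {q p} k → Prime q → Prime p → q < p → ¬ q ∣ p ^ k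
prime<p⇒∤p^k k q-prime p-prime q<p q∣p^k = ℕ.<⇒≢ q<p (prime∣prime^k⇒≡ k q-prime p-prime q∣p^k)

%-∣-reduce : ∀ m n d {r} .{{_ : NonZero n}} .{{_ : NonZero d}} → d ∣ n → m % n ≡ r → m % d ≡ r % d
%-∣-reduce m n d d∣n m%n≡r = trans (sym (m∣n⇒o%n%m≡o%m d n m d∣n)) (cong (_% d) m%n≡r)

module JInvariantZero (F : FiniteField) where
  open FF F
  open FieldCounting F
  open LegendreCurves F

  module _ (2≢0 : fromℕ 2 ≢ 0#) (3≢0 : fromℕ 3 ≢ 0#) where

    card%3≡2⇒jLeg≢0 : card % 3 ≡ 2 → ∀ l → l ≢ 0# → l ≢ 1# → jLeg l ≢ 0#
    card%3≡2⇒jLeg≢0 card%3≡2 l l≢0 l≢1 jLeg≡0 = contradiction (trans (sym card%3≡2) card%3≡1) λ ()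
      where
        Φ₆l≡0 : Φ₆ l ≡ 0#
        Φ₆l≡0 = jLeg≡0⇒Φ₆≡0 2≢0 l≢0 l≢1 jLeg≡0
        card%3≡1 : card % 3 ≡ 1
        card%3≡1 = primitive-cube-root⇒card%3≡1 (Φ₆≡0⇒-l≢1 3≢0 Φ₆l≡0) (Φ₆≡0⇒[-l]³≡1 Φ₆l≡0)

    card%12≡1⇒|L|≡2 : card % 12 ≡ 1 → ∀ l → l ≢ 0# → l ≢ 1# → jLeg l ≡ 0# → HasSize (L l) 2 × IsSquare l
    card%12≡1⇒|L|≡2 card%12≡1 l l≢0 l≢1 jLeg≡0 =
      √-1⇒|L|≡2 2≢0 3≢0 l≢0 l≢1 Φ₆l≡0 √-1 , √-1⇒IsSquare Φ₆l≡0 √-1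
      where
        Φ₆l≡0 : Φ₆ l ≡ 0#
        Φ₆l≡0 = jLeg≡0⇒Φ₆≡0 2≢0 l≢0 l≢1 jLeg≡0
        √-1 : IsSquare (- 1#)
        √-1 = decidable-stable (IsSquare? (- 1#)) λ ¬√-1 →
          contradiction (trans (sym (¬√-1⇒card%4≡3 2≢0 ¬√-1)) (%-∣-reduce card 12 4 (divides-refl 3) card%12≡1)) λ ()

    card%12≡7⇒|L|≡1 : card % 12 ≡ 7 → ∀ l → l ≢ 0# → l ≢ 1# → jLeg l ≡ 0# → HasSize (L l) 1 × ¬ IsSquare l
    card%12≡7⇒|L|≡1 card%12≡7 l l≢0 l≢1 jLeg≡0 =
      ¬√-1⇒|L|≡1 2≢0 3≢0 l≢0 l≢1 Φ₆l≡0 ¬√-1 , ¬√-1 ∘ IsSquare⇒√-1 Φ₆l≡0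
      where
        Φ₆l≡0 : Φ₆ l ≡ 0#
        Φ₆l≡0 = jLeg≡0⇒Φ₆≡0 2≢0 l≢0 l≢1 jLeg≡0
        ¬√-1 : ¬ IsSquare (- 1#)
        ¬√-1 √-1 = contradiction
          (trans (sym (√-1⇒card%4≡1 2≢0 √-1)) (%-∣-reduce card 12 4 (divides-refl 3) card%12≡7)) λ ()

lemma2p6 : (F : FiniteField) → let open FF F in
    (p k : ℕ) → Prime p → 5 ≤ p → 1 ≤ k → card ≡ p ^ k →
    ((card % 3 ≡ 2 → ∀ l → l ≢ 0# → l ≢ 1# → jLeg l ≢ 0#)
    × (card % 12 ≡ 1 → ∀ l → l ≢ 0# → l ≢ 1# → jLeg l ≡ 0# →
         HasSize (L l) 2 × IsSquare l)
    × (card % 12 ≡ 7 → ∀ l → l ≢ 0# → l ≢ 1# → jLeg l ≡ 0# →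
         HasSize (L l) 1 × ¬ IsSquare l))
lemma2p6 F p k p-prime 5≤p _ card≡p^k =
  card%3≡2⇒jLeg≢0 2≢0 3≢0 , card%12≡1⇒|L|≡2 2≢0 3≢0 , card%12≡7⇒|L|≡1 2≢0 3≢0
  where
    open FF F
    open FieldCounting F using (fromℕ2≡0⇒2∣card; fromℕ3≡0⇒3∣card)
    open JInvariantZero F

    ∤card : ∀ {q} → Prime q → q < 5 → ¬ q ∣ card
    ∤card q-prime q<5 = prime<p⇒∤p^k k q-prime p-prime (ℕ.<-≤-trans q<5 5≤p) ∘ subst (_ ∣_) card≡p^k

    2≢0 : fromℕ 2 ≢ 0#
    2≢0 = ∤card prime[2] (s≤s (s≤s (s≤s z≤n))) ∘ fromℕ2≡0⇒2∣card

    3≢0 : fromℕ 3 ≢ 0#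
    3≢0 = ∤card (toWitness {a? = prime? 3} _) (s≤s (s≤s (s≤s (s≤s z≤n)))) ∘ fromℕ3≡0⇒3∣card
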